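{- In the VC construction described in the context, let $C=C_{I,H,\sigma}$ and $C'=C_{I',H,\sigma'}$ be two concepts of $\mathcal{C}$ with the same $H\subseteq\mathcal{Y}$. For any subset $S\subseteq\mathcal{U}$ and any maximal non-repetitive subset $S_{\mathrm{nr}}\subseteq S$, if $S_{\mathrm{nr}}\subseteq C$ and $S_{\mathrm{nr}}\subseteq C'$, then $S\cap C=S\cap C'$.
   Context: Label Cover: $\mathcal{L}=(A,B,E,\Sigma,\{\pi_e\}_{e\in E})$ with bipartite graph $(A,B,E)$, finite alphabet $\Sigma$, maps $\pi_{(a,b)}:\Sigma\to\Sigma$; $\mathcal{L}$ is bi-regular. A partial assignment $\sigma$ defined on both endpoints of an edge $(a,b)$ violates it if $\pi_{(a,b)}(\sigma(a))\ne\sigma(b)$. $\Sigma^V$ denotes functions $V\to\Sigma$. VC construction (parameter $\delta>0$): $n=|A|+|B|$, $r=\sqrt{n}/\log n$ (even), $U_1,\dots,U_r$ a partition of $A\cup B$ with $n/(2r)\le|U_i|\le2n/r$ and $|E|/(2r^2)\le|(U_i\times U_j)\cap E|,|(U_j\times U_i)\cap E|\le2|E|/r^2$. For $i\ne j$, $\mathcal{N}_i(j)\subseteq U_i$ is the set of vertices of $U_i$ with a neighbor in $U_j$, $\mathcal{N}_i(J)=\bigcup_{j\in J}\mathcal{N}_i(j)$. Universe $\mathcal{U}=\mathcal{X}\cup\mathcal{Y}$, $\mathcal{X}=\{x_{i,\sigma_i}:i\in[r],\sigma_i\in\Sigma^{U_i}\}$, $\mathcal{Y}=\{y_1,\dots,y_r\}$.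 With $\ell=80/\delta^3$, for each $H\subseteq\mathcal{Y}$ pick $\ell$ random permutations of $[r]$, each giving the perfect matching pairing positions $2m-1,2m$; $M_H(i)$ is the set of indices matched with $i$ and $T_H=\bigcup_i\mathcal{N}_i(M_H(i))$. For $I\subseteq[r]$, $H\subseteq\mathcal{Y}$, $\sigma_H\in\Sigma^{T_H}$ violating no edge inside $T_H$, concept $C_{I,H,\sigma_H}$ contains $x_{i,\sigma_i}$ iff $i\in I$ and $\sigma_i,\sigma_H$ agree on $\mathcal{N}_i(M_H(i))$, and contains $y_i$ iff $y_i\in H$; $\mathcal{C}$ is the set of all such concepts. (The concept depends only on $\sigma_H$, so one may write $C_{I,H,\sigma}$ for a full assignment $\sigma$ whose restriction to $T_H$ is $\sigma_H$.) Notation: $\mathcal{X}_i=\{x_{i,\sigma_i}:\sigma_i\in\Sigma^{U_i}\}$. A set $S'\subseteq\mathcal{X}$ is non-repetitive if $|S'\cap\mathcal{X}_i|\le1$ for all $i$; a maximal non-repetitive subset of $S$ is a non-repetitive subset of $S$ not properly contained in another non-repetitive subset of $S$. -}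

module Defs where

open import Level using (0ℓ)
open import Data.Nat using (ℕ; zero; suc; _+_; _*_; _≤_; ⌊_/2⌋)
open import Data.Nat.Divisibility using (_∣_)
open import Data.Bool using (Bool; true; false; if_then_else_; _∧_)
open import Data.Fin as Fin using (Fin; toℕ)
open import Data.Fin.Subset using (Subset; _∈_)
open import Data.Fin.Permutation using (Permutation′; _⟨$⟩ˡ_)
open import Data.Vec using (Vec; lookup)
open import Data.Sum using (_⊎_; inj₁; inj₂)
open import Data.Product using (Σ; ∃; _×_; _,_; proj₁)
open import Function.Bundles using (_↔_; Inverse)
open import Relation.Nullary using (¬_; does)
open import Relation.Binary.PropositionalEquality using (_≡_; _≢_)
open import Relation.Unary using (Pred; _⊆_)

countF : (n : ℕ) → (Fin n → Bool) → ℕ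
countF zero    p = 0
countF (suc n) p = (if p Fin.zero then 1 else 0) + countF n (λ k → p (Fin.suc k))

sumF : (n : ℕ) → (Fin n → ℕ) → ℕ
sumF zero    f = 0
sumF (suc n) f = f Fin.zero + sumF n (λ k → f (Fin.suc k))

-- Label Cover instance  L = (A, B, E, Σ, {π_e}).
-- A = Fin na, B = Fin nb, Σ = Fin q (finite alphabet),
-- E a b = true iff (a , b) ∈ E,  π a b = π_{(a,b)} : Σ → Σ.

record LabelCover : Set where
  field
    na nb q : ℕ
    E  : Fin na → Fin nb → Bool
    π  : Fin na → Fin nb → Fin q → Fin q

  Alph : Set
  Alph = Fin q

  Vertex : Set
  Vertex = Fin na ⊎ Fin nb

  degA : Fin na → ℕ
  degA a = countF nb (λ b → E a b)

  degB : Fin nb → ℕ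
  degB b = countF na (λ a → E a b)

  numEdges : ℕ
  numEdges = sumF na degA

  Adj : Vertex → Vertex → Set
  Adj (inj₁ a) (inj₂ b) = E a b ≡ true
  Adj (inj₂ b) (inj₁ a) = E a b ≡ true
  Adj (inj₁ _) (inj₁ _) = Data.Empty.⊥
    where import Data.Empty
  Adj (inj₂ _) (inj₂ _) = Data.Empty.⊥
    where import Data.Empty

BiRegular : LabelCover → Set
BiRegular L = (∃ λ dA → ∀ a → degA a ≡ dA) × (∃ λ dB → ∀ b → degB b ≡ dB)
  where open LabelCover L

-- The partition U_1..U_r of A ∪ B is given by a bijection
--   loc : A ∪ B ↔ Σ (i : Fin r) (Fin (size i)),
-- so U_i ≅ Fin (size i) and Σ^{U_i} = Vec Σ (size i).
-- For each H ⊆ Y (H : Subset r) we are given ℓ permutations of [r]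
-- (perm H k maps positions to indices).

record VCConstruction (L : LabelCover) : Set where
  open LabelCover L
  field
    r     : ℕ
    size  : Fin r → ℕ
    loc   : Vertex ↔ Σ (Fin r) (λ i → Fin (size i))
    ℓ     : ℕ
    perm  : Subset r → Fin ℓ → Permutation′ r

  n : ℕ
  n = na + nb

  part : Vertex → Fin r
  part v = proj₁ (Inverse.to loc v)

  vertexAt : (i : Fin r) → Fin (size i) → Vertex
  vertexAt i k = Inverse.from loc (i , k)

  edgesBetween : Fin r → Fin r → ℕ
  edgesBetween i j = sumF na (λ a → countF nb (λ b →
    E a b ∧ (does (part (inj₁ a) Fin.≟ i) ∧ does (part (inj₂ b) Fin.≟ j))))

  field
    r-even     : 2 ∣ r
    size-lower : ∀ i → n ≤ 2 * r * size i                 -- n/(2r) ≤ |U_i|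
    size-upper : ∀ i → r * size i ≤ 2 * n                 -- |U_i| ≤ 2n/r
    edge-lower : ∀ i j → i ≢ j → numEdges ≤ 2 * (r * r) * edgesBetween i j
    edge-upper : ∀ i j → i ≢ j → (r * r) * edgesBetween i j ≤ 2 * numEdges

  InN : Fin r → Fin r → Vertex → Set
  InN i j v = part v ≡ i × ∃ λ w → part w ≡ j × Adj v w

  -- position of index i in the k-th permutation for H (0-based)
  pos : Subset r → Fin ℓ → Fin r → ℕ
  pos H k i = toℕ (perm H k ⟨$⟩ˡ i)

  -- j ∈ M_H(i): j is matched with i in one of the ℓ perfect matchings,
  -- the matching pairing (1-based) positions 2m-1, 2m
  M : Subset r → Fin r → Fin r → Set
  M H i j = ∃ λ k → i ≢ j × ⌊ pos H k i /2⌋ ≡ ⌊ pos H k j /2⌋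

  InNM : Subset r → Fin r → Vertex → Set
  InNM H i v = ∃ λ j → M H i j × InN i j v

  InT : Subset r → Vertex → Set
  InT H v = InNM H (part v) v

  Consistent : Subset r → (Vertex → Alph) → Set
  Consistent H σ = ∀ a b → E a b ≡ true → InT H (inj₁ a) → InT H (inj₂ b) →
                   π a b (σ (inj₁ a)) ≡ σ (inj₂ b)

  data Elem : Set where
    x : (i : Fin r) → Vec Alph (size i) → Elem
    y : Fin r → Elem

  IsX : Pred Elem 0ℓ
  IsX (x _ _) = ⊤ where open import Data.Unit using (⊤)
  IsX (y _)   = ⊥ where open import Data.Empty using (⊥)

  Concept : Subset r → Subset r → (Vertex → Alph) → Pred Elem 0ℓ
  Concept I H σ (x i σi) = i ∈ I × (∀ k → InNM H i (vertexAt i k) → lookup σi k ≡ σ (vertexAt i k))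
  Concept I H σ (y i)    = i ∈ H

  NonRepetitive : Pred Elem 0ℓ → Set
  NonRepetitive S′ = S′ ⊆ IsX × (∀ i σi τi → S′ (x i σi) → S′ (x i τi) → σi ≡ τi)

  MaximalNonRep : Pred Elem 0ℓ → Pred Elem 0ℓ → Set₁
  MaximalNonRep S S′ = S′ ⊆ S × NonRepetitive S′ ×
    (∀ (T : Pred Elem 0ℓ) → NonRepetitive T → S′ ⊆ T → T ⊆ S → T ⊆ S′)

-- A concept restricted to a block X_i is determined by i ∈ I and by σ on N_i(M_H(i)); the latter
-- is read off any x_{i,τ} in the concept. So once C and C′ share a point x_{i,τ} of block X_i,
-- they agree on all of X_i, and with the same H they agree on Y. By maximality, every block met
-- by S is met by S_nr ⊆ C ∩ C′. Only ¬¬ of that witness is constructive, but membership in a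
-- concept is decidable pointwise, hence ¬¬-stable.
module Submission where

open import Defs
open import Level using (0ℓ)
open import Data.Empty using (⊥-elim)
open import Data.Fin using (_≟_)
open import Data.Fin.Subset using (Subset)
open import Data.Fin.Subset.Properties using (_∈?_)
open import Data.Product using (∃; _×_; _,_; proj₁; proj₂)
open import Data.Sum using (_⊎_; inj₁; inj₂)
open import Data.Unit using (tt)
open import Data.Vec using (Vec; lookup)
open import Function using (_∘_)
open import Relation.Nullary using (¬_)
open import Relation.Nullary.Decidable using (decidable-stable)
open import Relation.Binary.PropositionalEquality using (_≡_; refl; sym; module ≡-Reasoning)
open import Relation.Unary using (Pred; _⊆_; _∩_; _≐_)

module _ {L : LabelCover} (V : VCConstruction L) where
  open LabelCover L using (Alph)
  open VCConstruction V

  Concept-stable : ∀ I H σ e → ¬ ¬ Concept I H σ e → Concept I H σ e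
  Concept-stable I H σ (x i σi) ¬¬c =
      decidable-stable (i ∈? I) (λ i∉I → ¬¬c (i∉I ∘ proj₁))
    , λ k nm → decidable-stable (lookup σi k ≟ σ (vertexAt i k))
                                 (λ ≢σ → ¬¬c (λ c → ≢σ (proj₂ c k nm)))
  Concept-stable I H σ (y i) ¬¬c = decidable-stable (i ∈? H) ¬¬c

  maximalNonRep-meets-block : ∀ {S Snr : Pred Elem 0ℓ} {i σi} →
    MaximalNonRep S Snr → S (x i σi) → ¬ ¬ ∃ λ τ → Snr (x i τ)
  maximalNonRep-meets-block {S} {Snr} {i} {σi} (Snr⊆S , (Snr⊆X , Snr-nr) , maximal) s ¬met =
    ¬met (σi , maximal T T-nonRep inj₁ T⊆S (inj₂ (refl , ¬met)))
    where
    T : Pred Elem 0ℓ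
    T e = Snr e ⊎ (e ≡ x i σi × ¬ ∃ λ τ → Snr (x i τ))

    T-nonRep : NonRepetitive T
    T-nonRep = (λ { (inj₁ sn) → Snr⊆X sn ; (inj₂ (refl , _)) → tt })
             , λ { j a b (inj₁ p) (inj₁ q) → Snr-nr j a b p q
                 ; j a b (inj₁ p) (inj₂ (refl , ¬q)) → ⊥-elim (¬q (a , p))
                 ; j a b (inj₂ (refl , ¬p)) (inj₁ q) → ⊥-elim (¬p (b , q))
                 ; j a b (inj₂ (refl , _)) (inj₂ (refl , _)) → refl }

    T⊆S : T ⊆ S
    T⊆S (inj₁ sn)         = Snr⊆S sn
    T⊆S (inj₂ (refl , _)) = s

  Concept-transfer-block : ∀ {I I′ H σ σ′ i} {τ σi : Vec Alph (size i)} →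
    Concept I H σ (x i τ) → Concept I′ H σ′ (x i τ) →
    Concept I H σ (x i σi) → Concept I′ H σ′ (x i σi)
  Concept-transfer-block {σ = σ} {σ′} {i} {τ} {σi} (_ , τ≈σ) (i∈I′ , τ≈σ′) (_ , σi≈σ) =
    i∈I′ , λ k nm → begin
      lookup σi k           ≡⟨ σi≈σ k nm ⟩
      σ (vertexAt i k)      ≡⟨ sym (τ≈σ k nm) ⟩
      lookup τ k            ≡⟨ τ≈σ′ k nm ⟩
      σ′ (vertexAt i k)     ∎
    where open ≡-Reasoning

  ∩-Concept-⊆ : ∀ {I I′ H σ σ′} {S Snr : Pred Elem 0ℓ} → MaximalNonRep S Snr →
    Snr ⊆ Concept I H σ → Snr ⊆ Concept I′ H σ′ →
    (S ∩ Concept I H σ) ⊆ Concept I′ H σ′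
  ∩-Concept-⊆ _ _ _ {y i} (_ , i∈H) = i∈H
  ∩-Concept-⊆ {I} {I′} {H} {σ} {σ′} maximal Snr⊆C Snr⊆C′ {x i σi} (s , c) =
    Concept-stable I′ H σ′ (x i σi) λ ¬c′ →
      maximalNonRep-meets-block maximal s λ (τ , sn) →
        ¬c′ (Concept-transfer-block {I} {I′} {H} {σ} {σ′} {τ = τ} {σi}
               (Snr⊆C sn) (Snr⊆C′ sn) c)

open LabelCover using (Vertex; Alph)
open VCConstruction using (r; Consistent; Elem; MaximalNonRep; Concept)

lemma16 : (L : LabelCover) → BiRegular L → (V : VCConstruction L) →
    (I I′ H : Subset (r V)) (σ σ′ : Vertex L → Alph L) →
    Consistent V H σ → Consistent V H σ′ →
    (S Snr : Pred (Elem V) 0ℓ) → MaximalNonRep V S Snr →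
    Snr ⊆ Concept V I H σ → Snr ⊆ Concept V I′ H σ′ →
    (S ∩ Concept V I H σ) ≐ (S ∩ Concept V I′ H σ′)
lemma16 L _ V I I′ H σ σ′ _ _ S Snr maximal Snr⊆C Snr⊆C′ =
    (λ p → proj₁ p , ∩-Concept-⊆ V maximal Snr⊆C Snr⊆C′ p)
  , (λ p → proj₁ p , ∩-Concept-⊆ V maximal Snr⊆C′ Snr⊆C p)
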